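{- Let $G$ be a partial cube and let $\mathcal P$ be a system of coordinating paths of $X(G)$. Then there is an isometric embedding of $G$ into $\Gamma_{f'}$, where $f'={\rm idim}(G)+|\mathcal P|-1$.
   Context: All graphs are finite. The $d$-cube $Q_d$ has vertex set $\{0,1\}^d$, two vertices adjacent iff they differ in exactly one coordinate. A Fibonacci string of length $d$ is a binary string of length $d$ with no two consecutive $1$s; the Fibonacci cube $\Gamma_d$ is the subgraph of $Q_d$ induced by the Fibonacci strings of length $d$. An isometric embedding of $G$ into $H$ is an injective map $V(G)\to V(H)$ preserving shortest-path distances. A partial cube is a graph that isometrically embeds into some hypercube; ${\rm idim}(G)$ is the least $k$ such that $G$ isometrically embeds into $Q_k$. Semicubes and $X(G)$: let $G$ be a partial cube, $k={\rm idim}(G)$, and fix an isometric embedding $\beta:V(G)\to V(Q_k)$ (every coordinate $\beta^{(i)}$ takes both values $0,1$ on $V(G)$). For $(i,\chi)\in[k]\times\{0,1\}$ the semicube is $W_{(i,\chi)}=\{u\in V(G)\mid \beta^{(i)}(u)=\chi\}$, and $W_{(i,0)},W_{(i,1)}$ form a complementary pair. $X(G)$ is the graph whose nodes are the $2k$ semicubes, where $W_{(i,\chi)}$ and $W_{(j,\chi')}$ are adjacent iff $i\neq j$ and $W_{(i,\chi)}\cap W_{(j,\chi')}=\emptyset$. A coordinating path is a path $P$ of $X(G)$ (a single node counts as a path) containing at most one node of each complementary pair. A system of coordinating paths is a set $\mathcal P$ of coordinating paths such that for each $i\in[k]$ there is exactly one $P\in\mathcal P$ containing a node of $\{W_{(i,0)},W_{(i,1)}\}$.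 -}

module Defs where

open import Data.Nat using (ℕ; zero; suc; _≤_; _+_; _∸_)
open import Data.Bool using (Bool; true; false)
open import Data.Fin using (Fin)
open import Data.Vec using (Vec; []; _∷_; lookup)
open import Data.List using (List; []; _∷_; length)
import Data.List as L
open import Data.List.Membership.Propositional using (_∈_)
open import Data.List.Relation.Unary.Linked using (Linked)
open import Data.List.Relation.Unary.AllPairs using (AllPairs)
open import Data.Product using (Σ; ∃; _×_; _,_; proj₁)
open import Relation.Nullary using (¬_)
open import Relation.Binary.PropositionalEquality using (_≡_; _≢_)
open import Function.Definitions using (Injective)

record Graph : Set₁ where
  field
    V     : Set
    Adj   : V → V → Set
    sym   : ∀ {u v} → Adj u v → Adj v u
    irrefl : ∀ {u} → ¬ Adj u u
open Graph public

data Walk (G : Graph) : V G → V G → ℕ → Set where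
  here : ∀ {u} → Walk G u u zero
  step : ∀ {u v w n} → Adj G u v → Walk G v w n → Walk G u w (suc n)

Dist : (G : Graph) → V G → V G → ℕ → Set
Dist G u v d = Walk G u v d × (∀ m → Walk G u v m → d ≤ m)

record IsometricEmbedding (G H : Graph) : Set where
  field
    map       : V G → V H
    injective : Injective _≡_ _≡_ map
    isometric : ∀ u v d → (Dist G u v d → Dist H (map u) (map v) d)
                         × (Dist H (map u) (map v) d → Dist G u v d)
open IsometricEmbedding public

DifferInOne : ∀ {d} → Vec Bool d → Vec Bool d → Set
DifferInOne {d} x y =
  Σ (Fin d) λ i → (lookup x i ≢ lookup y i) × (∀ j → j ≢ i → lookup x j ≡ lookup y j)

Q : ℕ → Graph
Q d = record
  { V = Vec Bool d
  ; Adj = DifferInOne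
  ; sym = λ { (i , ne , eq) → i , (λ e → ne (Relation.Binary.PropositionalEquality.sym e))
                              , (λ j j≢i → Relation.Binary.PropositionalEquality.sym (eq j j≢i)) }
  ; irrefl = λ { (i , ne , _) → ne Relation.Binary.PropositionalEquality.refl }
  }

data NoTwoOnes : ∀ {d} → Vec Bool d → Set where
  nil   : NoTwoOnes []
  one   : ∀ {b} → NoTwoOnes (b ∷ [])
  zero∷ : ∀ {d b} {x : Vec Bool d} → NoTwoOnes (b ∷ x) → NoTwoOnes (false ∷ b ∷ x)
  one∷  : ∀ {d} {x : Vec Bool d} → NoTwoOnes (false ∷ x) → NoTwoOnes (true ∷ false ∷ x)

Γ : ℕ → Graph
Γ d = record
  { V = Σ (Vec Bool d) NoTwoOnes
  ; Adj = λ x y → DifferInOne (proj₁ x) (proj₁ y)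
  ; sym = λ {x} {y} → Graph.sym (Q d) {proj₁ x} {proj₁ y}
  ; irrefl = λ {x} → Graph.irrefl (Q d) {proj₁ x}
  }

IsIdim : Graph → ℕ → Set
IsIdim G k = IsometricEmbedding G (Q k) × (∀ k' → IsometricEmbedding G (Q k') → k ≤ k')

module Semicubes (G : Graph) (k : ℕ) (β : IsometricEmbedding G (Q k)) where

  -- node (i , χ) of X(G) stands for the semicube W_(i,χ)
  Node : Set
  Node = Fin k × Bool

  _∈W_ : V G → Node → Set
  u ∈W (i , χ) = lookup (IsometricEmbedding.map β u) i ≡ χ

  XAdj : Node → Node → Set
  XAdj (i , χ) (j , χ') = (i ≢ j) × (∀ u → ¬ ((u ∈W (i , χ)) × (u ∈W (j , χ'))))

  -- a coordinating path: nonempty sequence of nodes, consecutive ones adjacent in X(G),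
  -- at most one node of each complementary pair (i.e. coordinates pairwise distinct;
  -- this also makes the nodes pairwise distinct, so it is a path)
  record CoordPath : Set where
    field
      nodes    : List Node
      nonempty : nodes ≢ []
      linked   : Linked XAdj nodes
      distinct : AllPairs (λ a b → proj₁ a ≢ proj₁ b) nodes
  open CoordPath public

  -- the path contains a node of {W_(i,0), W_(i,1)}
  Meets : CoordPath → Fin k → Set
  Meets P i = i ∈ L.map proj₁ (nodes P)

  -- a system of coordinating paths, given as a list of paths; for each i exactly one
  -- member (position) of the list meets the pair {W_(i,0), W_(i,1)}
  IsSystem : List CoordPath → Set
  IsSystem 𝒫 = ∀ (i : Fin k) → Σ (Fin (length 𝒫)) λ p →
                 Meets (L.lookup 𝒫 p) i × (∀ q → Meets (L.lookup 𝒫 q) i → q ≡ p)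

module Submission where

-- For a vertex u and a path
-- P = (i₁,χ₁) … (iₘ,χₘ) the block of u along P is the bit string recording
-- whether u lies in the semicubes W_(i₁,χ₁), …, W_(iₘ,χₘ); the code of u is
-- the concatenation of its blocks along the paths of 𝒫, separated by single 0s.
--   * Consecutive nodes of a path are disjoint semicubes, so no block contains
--     two consecutive 1s; the separators are 0s, so the code is a Fibonacci string.
--   * Every coordinate occurs in exactly one path, exactly once, so the code has
--     length k + |𝒫| - 1 and the Hamming distance of two codes equals the Hamming
--     distance of the corresponding vertices of Q_k.

open import Defs hiding (sym; map)
open import Algebra.Properties.CommutativeSemigroup using (interchange)
open import Data.Bool using (Bool; true; false; not)
open import Data.Empty using (⊥-elim)
open import Data.Fin using (Fin) renaming (zero to fzero; suc to fsuc)
import Data.Fin.Properties as Fin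
open import Data.List using (List; []; _∷_; _++_; length; allFin; concatMap; tabulate; head; last)
import Data.List as L
import Data.List.Properties as L
open import Data.List.Membership.Propositional using (_∈_)
open import Data.List.Membership.Propositional.Properties using (∈-++⁺ˡ; ∈-++⁺ʳ; ∈-++⁻; ∈-allFin)
open import Data.List.Membership.Propositional.Properties.WithK using (unique∧set⇒bag)
open import Data.List.Relation.Binary.BagAndSetEquality using (∼bag⇒↭)
open import Data.List.Relation.Binary.Permutation.Propositional using (_↭_)
open import Data.List.Relation.Binary.Permutation.Propositional.Properties using (↭-length)
  renaming (map⁺ to ↭-map⁺)
open import Data.List.Relation.Unary.Linked as Linked using (Linked; []; [-]; _∷_; _∷′_)
import Data.List.Relation.Unary.Linked.Properties as Linked
open import Data.List.Relation.Unary.AllPairs using ([])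
import Data.List.Relation.Unary.AllPairs.Properties as AllPairs
open import Data.List.Relation.Unary.Unique.Propositional using (Unique)
import Data.List.Relation.Unary.Unique.Propositional.Properties as Unique
open import Data.Maybe using (just; nothing)
open import Data.Maybe.Relation.Binary.Connected using (Connected; just; just-nothing; nothing-just)
open import Data.Nat using (ℕ; zero; suc; _+_; _∸_; _≤_; z≤n; s≤s)
open import Data.Nat.ListAction using (sum)
open import Data.Nat.ListAction.Properties using (sum-++; sum-↭)
open import Data.Nat.Properties
  using (+-assoc; +-suc; +-identityʳ; +-mono-≤; ≤-antisym; ≤-reflexive; suc-injective;
         m+n≡0⇒m≡0; m+n≡0⇒n≡0; m+n∸n≡m; +-commutativeSemigroup; module ≤-Reasoning)
open import Data.Product using (Σ; _×_; _,_; proj₁; proj₂)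
open import Data.Sum using (_⊎_; inj₁; inj₂)
open import Data.Vec using (Vec; []; _∷_; lookup; toList; fromList)
open import Data.Vec.Properties using (toList∘fromList)
open import Data.Vec.Relation.Binary.Pointwise.Extensional using (ext; Pointwise-≡⇒≡)
open import Function.Base using (_∘_)
open import Function.Bundles using (mk⇔)
open import Relation.Nullary using (¬_)
open import Relation.Binary.PropositionalEquality
  using (_≡_; _≢_; refl; sym; trans; cong; cong₂; subst; module ≡-Reasoning)

δ : Bool → Bool → ℕ
δ false false = 0
δ true  true  = 0
δ false true  = 1
δ true  false = 1

δ-self : ∀ a → δ a a ≡ 0
δ-self false = refl
δ-self true  = refl

δ-zero : ∀ {a b} → δ a b ≡ 0 → a ≡ b
δ-zero {false} {false} _ = refl
δ-zero {true}  {true}  _ = refl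
δ-zero {false} {true}  ()
δ-zero {true}  {false} ()

δ-triangle : ∀ a b c → δ a c ≤ δ a b + δ b c
δ-triangle false false false = z≤n
δ-triangle false false true  = s≤s z≤n
δ-triangle false true  false = z≤n
δ-triangle false true  true  = s≤s z≤n
δ-triangle true  false false = s≤s z≤n
δ-triangle true  false true  = z≤n
δ-triangle true  true  false = s≤s z≤n
δ-triangle true  true  true  = z≤n

hamming : List Bool → List Bool → ℕ
hamming (a ∷ l) (b ∷ m) = δ a b + hamming l m
hamming _       _       = 0

hamming-++ : ∀ (l l′ m m′ : List Bool) → length l ≡ length l′ →
             hamming (l ++ m) (l′ ++ m′) ≡ hamming l l′ + hamming m m′
hamming-++ []      []       m m′ _  = refl
hamming-++ (a ∷ l) (b ∷ l′) m m′ eq =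
  trans (cong (δ a b +_) (hamming-++ l l′ m m′ (suc-injective eq)))
        (sym (+-assoc (δ a b) _ _))
hamming-++ []      (_ ∷ _)  _ _ ()
hamming-++ (_ ∷ _) []       _ _ ()

ham : ∀ {n} → Vec Bool n → Vec Bool n → ℕ
ham x y = hamming (toList x) (toList y)

ham-self : ∀ {n} (x : Vec Bool n) → ham x x ≡ 0
ham-self []      = refl
ham-self (a ∷ x) rewrite δ-self a = ham-self x

ham-zero : ∀ {n} (x y : Vec Bool n) → ham x y ≡ 0 → x ≡ y
ham-zero []      []      _  = refl
ham-zero (a ∷ x) (b ∷ y) eq =
  cong₂ _∷_ (δ-zero (m+n≡0⇒m≡0 (δ a b) eq)) (ham-zero x y (m+n≡0⇒n≡0 (δ a b) eq))

ham-triangle : ∀ {n} (x y z : Vec Bool n) → ham x z ≤ ham x y + ham y z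
ham-triangle []      []      []      = z≤n
ham-triangle (a ∷ x) (b ∷ y) (c ∷ z) = begin
  δ a c + ham x z                       ≤⟨ +-mono-≤ (δ-triangle a b c) (ham-triangle x y z) ⟩
  (δ a b + δ b c) + (ham x y + ham y z) ≡⟨ interchange +-commutativeSemigroup (δ a b) _ _ _ ⟩
  (δ a b + ham x y) + (δ b c + ham y z) ∎
  where open ≤-Reasoning

coordDist : ∀ {n} → Vec Bool n → Vec Bool n → Fin n → ℕ
coordDist x y i = δ (lookup x i) (lookup y i)

sum-coordDist : ∀ {n} (x y : Vec Bool n) → sum (L.map (coordDist x y) (allFin n)) ≡ ham x y
sum-coordDist x y = trans (cong sum (L.map-tabulate (λ i → i) (coordDist x y))) (sum-tabulate x y)
  where
    sum-tabulate : ∀ {n} (x y : Vec Bool n) → sum (tabulate (coordDist x y)) ≡ ham x y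
    sum-tabulate []      []      = refl
    sum-tabulate (a ∷ x) (b ∷ y) = cong (δ a b +_) (sum-tabulate x y)

differInOne-tail : ∀ {n a} {x y : Vec Bool n} → DifferInOne x y → DifferInOne (a ∷ x) (a ∷ y)
differInOne-tail (i , ne , eq) =
  fsuc i , ne , λ { fzero _ → refl ; (fsuc j) j≢i → eq j (λ j≡i → j≢i (cong fsuc j≡i)) }

differInOne-head : ∀ {n a b} {x : Vec Bool n} → a ≢ b → DifferInOne (a ∷ x) (b ∷ x)
differInOne-head ne = fzero , ne , λ { fzero 0≢0 → ⊥-elim (0≢0 refl) ; (fsuc j) _ → refl }

differInOne-cons : ∀ {n a b} {x y : Vec Bool n} → DifferInOne (a ∷ x) (b ∷ y) →
                   (a ≢ b × x ≡ y) ⊎ (a ≡ b × DifferInOne x y)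
differInOne-cons (fzero , ne , eq) =
  inj₁ (ne , Pointwise-≡⇒≡ (ext λ j → eq (fsuc j) λ ()))
differInOne-cons (fsuc i , ne , eq) =
  inj₂ (eq fzero (λ ()) , i , ne , λ j j≢i → eq (fsuc j) (λ e → j≢i (Fin.suc-injective e)))

differInOne⇒ham≡1 : ∀ {n} (x y : Vec Bool n) → DifferInOne x y → ham x y ≡ 1
differInOne⇒ham≡1 (a ∷ x) (b ∷ y) d with differInOne-cons d
differInOne⇒ham≡1 (false ∷ x) (false ∷ .x) _ | inj₁ (ne , refl) = ⊥-elim (ne refl)
differInOne⇒ham≡1 (true  ∷ x) (true  ∷ .x) _ | inj₁ (ne , refl) = ⊥-elim (ne refl)
differInOne⇒ham≡1 (false ∷ x) (true  ∷ .x) _ | inj₁ (_ , refl)  = cong suc (ham-self x)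
differInOne⇒ham≡1 (true  ∷ x) (false ∷ .x) _ | inj₁ (_ , refl)  = cong suc (ham-self x)
differInOne⇒ham≡1 (a ∷ x) (.a ∷ y) _ | inj₂ (refl , d′) =
  trans (cong (_+ ham x y) (δ-self a)) (differInOne⇒ham≡1 x y d′)

ham≡1⇒differInOne : ∀ {n} (x y : Vec Bool n) → ham x y ≡ 1 → DifferInOne x y
ham≡1⇒differInOne (false ∷ x) (false ∷ y) eq = differInOne-tail (ham≡1⇒differInOne x y eq)
ham≡1⇒differInOne (true  ∷ x) (true  ∷ y) eq = differInOne-tail (ham≡1⇒differInOne x y eq)
ham≡1⇒differInOne (false ∷ x) (true  ∷ y) eq
  rewrite ham-zero x y (suc-injective eq) = differInOne-head (λ ())
ham≡1⇒differInOne (true  ∷ x) (false ∷ y) eq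
  rewrite ham-zero x y (suc-injective eq) = differInOne-head (λ ())

walk-bound : ∀ {n m} {x z : Vec Bool n} → Walk (Q n) x z m → ham x z ≤ m
walk-bound {x = x} here = ≤-reflexive (ham-self x)
walk-bound {m = suc m} {x} {z} (step {v = y} d w) = begin
  ham x z           ≤⟨ ham-triangle x y z ⟩
  ham x y + ham y z ≡⟨ cong (_+ ham y z) (differInOne⇒ham≡1 x y d) ⟩
  suc (ham y z)     ≤⟨ s≤s (walk-bound w) ⟩
  suc m             ∎
  where open ≤-Reasoning

prefix-walk : ∀ {n m a} {x y : Vec Bool n} → Walk (Q n) x y m → Walk (Q (suc n)) (a ∷ x) (a ∷ y) m
prefix-walk here       = here
prefix-walk (step d w) = step (differInOne-tail d) (prefix-walk w)

hamming-walk : ∀ {n} (x y : Vec Bool n) → Walk (Q n) x y (ham x y)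
hamming-walk []          []          = here
hamming-walk (false ∷ x) (false ∷ y) = prefix-walk (hamming-walk x y)
hamming-walk (true  ∷ x) (true  ∷ y) = prefix-walk (hamming-walk x y)
hamming-walk (false ∷ x) (true  ∷ y) = step (differInOne-head (λ ())) (prefix-walk (hamming-walk x y))
hamming-walk (true  ∷ x) (false ∷ y) = step (differInOne-head (λ ())) (prefix-walk (hamming-walk x y))

cube-distance : ∀ {n} (x y : Vec Bool n) → Dist (Q n) x y (ham x y)
cube-distance x y = hamming-walk x y , λ _ w → walk-bound w

dist-unique : ∀ {H : Graph} {u v d d′} → Dist H u v d → Dist H u v d′ → d ≡ d′
dist-unique (w , min) (w′ , min′) = ≤-antisym (min _ w′) (min′ _ w)

adjacent-distance : ∀ {H : Graph} {u v} → Adj H u v → Dist H u v 1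
adjacent-distance {H} a = step a here , positive
  where
    positive : ∀ m → Walk H _ _ m → 1 ≤ m
    positive zero    here = ⊥-elim (irrefl H a)
    positive (suc m) _    = s≤s z≤n

Γ-walk⇒cube-walk : ∀ {N m} {p q : V (Γ N)} → Walk (Γ N) p q m → Walk (Q N) (proj₁ p) (proj₁ q) m
Γ-walk⇒cube-walk here       = here
Γ-walk⇒cube-walk (step a w) = step a (Γ-walk⇒cube-walk w)

-- Any map G → Γ_N that preserves the
-- Hamming distances between β-images is an isometric embedding: distances in both
-- G and the image are forced to equal these Hamming distances.
module _ {G : Graph} {k : ℕ} (β : IsometricEmbedding G (Q k)) where

  private
    β⟨_⟩ : V G → Vec Bool k
    β⟨_⟩ = IsometricEmbedding.map β

  distance-via-β : ∀ u v → Dist G u v (ham β⟨ u ⟩ β⟨ v ⟩)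
  distance-via-β u v = proj₂ (isometric β u v _) (cube-distance β⟨ u ⟩ β⟨ v ⟩)

  adjacent-via-β : ∀ {u v} → Adj G u v → ham β⟨ u ⟩ β⟨ v ⟩ ≡ 1
  adjacent-via-β {u} {v} a =
    dist-unique (cube-distance β⟨ u ⟩ β⟨ v ⟩) (proj₁ (isometric β u v 1) (adjacent-distance a))

  hamming-preserving⇒isometric :
    ∀ {N} (f : V G → V (Γ N)) →
    (∀ u v → ham (proj₁ (f u)) (proj₁ (f v)) ≡ ham β⟨ u ⟩ β⟨ v ⟩) →
    IsometricEmbedding G (Γ N)
  hamming-preserving⇒isometric {N} f preserves = record
    { map       = f
    ; injective = injective-f
    ; isometric = λ u v d → forward u v d , backward u v d
    }
    where
      adjacent-image : ∀ {u v} → Adj G u v → Adj (Γ N) (f u) (f v)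
      adjacent-image {u} {v} a =
        ham≡1⇒differInOne (proj₁ (f u)) (proj₁ (f v)) (trans (preserves u v) (adjacent-via-β a))

      walk-image : ∀ {u v m} → Walk G u v m → Walk (Γ N) (f u) (f v) m
      walk-image here       = here
      walk-image (step a w) = step (adjacent-image a) (walk-image w)

      image-distance : ∀ u v → Dist (Γ N) (f u) (f v) (ham β⟨ u ⟩ β⟨ v ⟩)
      image-distance u v = walk-image (proj₁ (distance-via-β u v)) , λ m w →
        subst (_≤ m) (preserves u v) (walk-bound (Γ-walk⇒cube-walk w))

      forward : ∀ u v d → Dist G u v d → Dist (Γ N) (f u) (f v) d
      forward u v d D = subst (Dist (Γ N) (f u) (f v)) (sym (dist-unique D (distance-via-β u v)))
                              (image-distance u v)

      backward : ∀ u v d → Dist (Γ N) (f u) (f v) d → Dist G u v d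
      backward u v d D = subst (Dist G u v) (sym (dist-unique D (image-distance u v)))
                               (distance-via-β u v)

      injective-f : ∀ {u v} → f u ≡ f v → u ≡ v
      injective-f {u} {v} fu≡fv = injective β (ham-zero _ _ (begin
        ham β⟨ u ⟩ β⟨ v ⟩               ≡⟨ sym (preserves u v) ⟩
        ham (proj₁ (f u)) (proj₁ (f v)) ≡⟨ cong (λ p → ham (proj₁ (f u)) (proj₁ p)) (sym fu≡fv) ⟩
        ham (proj₁ (f u)) (proj₁ (f u)) ≡⟨ ham-self (proj₁ (f u)) ⟩
        0                               ∎))
        where open ≡-Reasoning

NoOneOne : Bool → Bool → Set
NoOneOne a b = a ≡ true → b ≡ false

Fib : List Bool → Set
Fib = Linked NoOneOne

fib-separated : ∀ {l m} → Fib l → Fib m → Fib (l ++ false ∷ m)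
fib-separated {l} {m} fl fm = Linked.++⁺ fl (into0 (last l)) (from0 (head m) ∷′ fm)
  where
    into0 : ∀ b → Connected NoOneOne b (just false)
    into0 (just _) = just (λ _ → refl)
    into0 nothing  = nothing-just
    from0 : ∀ b → Connected NoOneOne (just false) b
    from0 (just _) = just (λ ())
    from0 nothing  = just-nothing

fib⇒NoTwoOnes : ∀ {l} → Fib l → NoTwoOnes (fromList l)
fib⇒NoTwoOnes []                                 = nil
fib⇒NoTwoOnes [-]                                = one
fib⇒NoTwoOnes {false ∷ _ ∷ _} (_ ∷ rest)         = zero∷ (fib⇒NoTwoOnes rest)
fib⇒NoTwoOnes {true ∷ _ ∷ _}  (noOneOne ∷ rest) with noOneOne refl
... | refl = one∷ (fib⇒NoTwoOnes rest)

fibVertex : ∀ {N} (l : List Bool) → length l ≡ N → Fib l → V (Γ N)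
fibVertex l refl fl = fromList l , fib⇒NoTwoOnes fl

toList-fibVertex : ∀ {N} (l : List Bool) (eq : length l ≡ N) (fl : Fib l) →
                   toList (proj₁ (fibVertex l eq fl)) ≡ l
toList-fibVertex l refl _ = toList∘fromList l

joinMap : {A : Set} → (A → List Bool) → List A → List Bool
joinMap b []                = []
joinMap b (a ∷ [])          = b a
joinMap b (a ∷ as@(_ ∷ _)) = b a ++ false ∷ joinMap b as

-- n blocks need n - 1 separators.
length-joinMap : {A : Set} (b : A → List Bool) (as : List A) →
                 length (joinMap b as) ≡ sum (L.map (length ∘ b) as) + length as ∸ 1
length-joinMap b []       = refl
length-joinMap b (a ∷ []) = sym (trans (m+n∸n≡m _ 1) (+-identityʳ _))
length-joinMap b (a ∷ as@(_ ∷ as′)) = begin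
  length (b a ++ false ∷ joinMap b as) ≡⟨ L.length-++ (b a) ⟩
  ℓ + suc (length (joinMap b as))      ≡⟨ cong (λ t → ℓ + suc t) (length-joinMap b as) ⟩
  ℓ + suc (S + suc n ∸ 1)              ≡⟨ cong (λ t → ℓ + suc (t ∸ 1)) (+-suc S n) ⟩
  ℓ + suc (S + n)                      ≡⟨ cong (ℓ +_) (sym (+-suc S n)) ⟩
  ℓ + (S + suc n)                      ≡⟨ sym (+-assoc ℓ S (suc n)) ⟩
  ℓ + S + suc n                        ≡⟨ cong (_∸ 1) (sym (+-suc (ℓ + S) (suc n))) ⟩
  ℓ + S + suc (suc n) ∸ 1              ∎
  where
    open ≡-Reasoning
    ℓ = length (b a)
    S = sum (L.map (length ∘ b) as)
    n = length as′

-- Separators agree, so the Hamming distance is the sum of the blockwise distances.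
hamming-joinMap : {A : Set} (b c : A → List Bool) → (∀ a → length (b a) ≡ length (c a)) →
                  ∀ as → hamming (joinMap b as) (joinMap c as) ≡ sum (L.map (λ a → hamming (b a) (c a)) as)
hamming-joinMap b c same []               = refl
hamming-joinMap b c same (a ∷ [])         = sym (+-identityʳ _)
hamming-joinMap b c same (a ∷ as@(_ ∷ _)) =
  trans (hamming-++ (b a) (c a) _ _ (same a)) (cong (hamming (b a) (c a) +_) (hamming-joinMap b c same as))

fib-joinMap : {A : Set} (b : A → List Bool) → (∀ a → Fib (b a)) → ∀ as → Fib (joinMap b as)
fib-joinMap b fb []               = []
fib-joinMap b fb (a ∷ [])         = fb a
fib-joinMap b fb (a ∷ as@(_ ∷ _)) = fib-separated (fb a) (fib-joinMap b fb as)

sum-map-concatMap : {A B : Set} (f : B → ℕ) (g : A → List B) (as : List A) →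
                    sum (L.map f (concatMap g as)) ≡ sum (L.map (sum ∘ L.map f ∘ g) as)
sum-map-concatMap f g []       = refl
sum-map-concatMap f g (a ∷ as) = begin
  sum (L.map f (g a ++ concatMap g as))              ≡⟨ cong sum (L.map-++ f (g a) _) ⟩
  sum (L.map f (g a) ++ L.map f (concatMap g as))    ≡⟨ sum-++ (L.map f (g a)) _ ⟩
  sum (L.map f (g a)) + sum (L.map f (concatMap g as)) ≡⟨ cong (_ +_) (sum-map-concatMap f g as) ⟩
  sum (L.map f (g a)) + sum (L.map (sum ∘ L.map f ∘ g) as) ∎
  where open ≡-Reasoning

length-concatMap : {A B : Set} (g : A → List B) (as : List A) →
                   length (concatMap g as) ≡ sum (L.map (length ∘ g) as)
length-concatMap g []       = refl
length-concatMap g (a ∷ as) = trans (L.length-++ (g a)) (cong (length (g a) +_) (length-concatMap g as))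

-- agree a χ is the bit "a = χ"; a vertex x lies in W_(i,χ) iff agree (x_i) χ = true.
agree : Bool → Bool → Bool
agree a true  = a
agree a false = not a

agree-true : ∀ {a χ} → agree a χ ≡ true → a ≡ χ
agree-true {a}     {true}  eq = eq
agree-true {false} {false} _  = refl
agree-true {true}  {false} ()

δ-agree : ∀ a b χ → δ (agree a χ) (agree b χ) ≡ δ a b
δ-agree a     b     true  = refl
δ-agree false false false = refl
δ-agree false true  false = refl
δ-agree true  false false = refl
δ-agree true  true  false = refl

module CoordinateCode {G : Graph} {k : ℕ} (β : IsometricEmbedding G (Q k)) where
  open Semicubes G k β

  private
    β⟨_⟩ : V G → Vec Bool k
    β⟨_⟩ = IsometricEmbedding.map β

  bit : Vec Bool k → Node → Bool
  bit x (i , χ) = agree (lookup x i) χ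

  coords : CoordPath → List (Fin k)
  coords P = L.map proj₁ (nodes P)

  allCoords : List CoordPath → List (Fin k)
  allCoords = concatMap coords

  block : Vec Bool k → CoordPath → List Bool
  block x P = L.map (bit x) (nodes P)

  code : Vec Bool k → List CoordPath → List Bool
  code x 𝒫 = joinMap (block x) 𝒫

  length-block : ∀ x P → length (block x P) ≡ length (coords P)
  length-block x P = trans (L.length-map (bit x) (nodes P)) (sym (L.length-map proj₁ (nodes P)))

  hamming-block : ∀ x y P → hamming (block x P) (block y P) ≡ sum (L.map (coordDist x y) (coords P))
  hamming-block x y P = along (nodes P)
    where
      along : ∀ ns → hamming (L.map (bit x) ns) (L.map (bit y) ns) ≡ sum (L.map (coordDist x y) (L.map proj₁ ns))
      along []             = refl
      along ((i , χ) ∷ ns) = cong₂ _+_ (δ-agree (lookup x i) (lookup y i) χ) (along ns)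

  -- Consecutive nodes of a path are disjoint semicubes, so blocks of vertices of G are Fibonacci.
  fib-block : ∀ u P → Fib (block β⟨ u ⟩ P)
  fib-block u P = Linked.map⁺ (Linked.map disjoint⇒NoOneOne (linked P))
    where
      disjoint⇒NoOneOne : ∀ {m n} → XAdj m n → NoOneOne (bit β⟨ u ⟩ m) (bit β⟨ u ⟩ n)
      disjoint⇒NoOneOne {i , χ} {j , χ′} (_ , disjoint) u∈m with agree (lookup β⟨ u ⟩ j) χ′ in u∈n
      ... | false = refl
      ... | true  = ⊥-elim (disjoint u (agree-true u∈m , agree-true u∈n))

  fib-code : ∀ u 𝒫 → Fib (code β⟨ u ⟩ 𝒫)
  fib-code u = fib-joinMap (block β⟨ u ⟩) (fib-block u)

  ∈-allCoords⁺ : ∀ 𝒫 (p : Fin (length 𝒫)) {i} → Meets (L.lookup 𝒫 p) i → i ∈ allCoords 𝒫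
  ∈-allCoords⁺ (P ∷ 𝒫) fzero    m = ∈-++⁺ˡ m
  ∈-allCoords⁺ (P ∷ 𝒫) (fsuc p) m = ∈-++⁺ʳ (coords P) (∈-allCoords⁺ 𝒫 p m)

  ∈-allCoords⁻ : ∀ 𝒫 {i} → i ∈ allCoords 𝒫 → Σ (Fin (length 𝒫)) λ p → Meets (L.lookup 𝒫 p) i
  ∈-allCoords⁻ (P ∷ 𝒫) m with ∈-++⁻ (coords P) m
  ... | inj₁ m′ = fzero , m′
  ... | inj₂ m′ with ∈-allCoords⁻ 𝒫 m′
  ... | p , mp = fsuc p , mp

  allCoords-unique : ∀ 𝒫 → (∀ {i} p q → Meets (L.lookup 𝒫 p) i → Meets (L.lookup 𝒫 q) i → p ≡ q) →
                     Unique (allCoords 𝒫)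
  allCoords-unique []      _        = []
  allCoords-unique (P ∷ 𝒫) atMostOne =
    Unique.++⁺ (AllPairs.map⁺ (distinct P))
               (allCoords-unique 𝒫 (λ p q mp mq → Fin.suc-injective (atMostOne (fsuc p) (fsuc q) mp mq)))
               disjoint
    where
      -- a coordinate of P also met by a later path would meet two different paths
      disjoint : ∀ {i} → ¬ (i ∈ coords P × i ∈ allCoords 𝒫)
      disjoint (mP , m𝒫) with ∈-allCoords⁻ 𝒫 m𝒫
      ... | p , mp = Fin.0≢1+n (atMostOne fzero (fsuc p) mP mp)

  allCoords↭allFin : ∀ 𝒫 → IsSystem 𝒫 → allCoords 𝒫 ↭ allFin k
  allCoords↭allFin 𝒫 system = ∼bag⇒↭ (unique∧set⇒bag (allCoords-unique 𝒫 atMostOne) (Unique.allFin⁺ k)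
    λ {i} → mk⇔ (λ _ → ∈-allFin i) (λ _ → ∈-allCoords⁺ 𝒫 (proj₁ (system i)) (proj₁ (proj₂ (system i)))))
    where
      atMostOne : ∀ {i} p q → Meets (L.lookup 𝒫 p) i → Meets (L.lookup 𝒫 q) i → p ≡ q
      atMostOne {i} p q mp mq = trans (proj₂ (proj₂ (system i)) p mp) (sym (proj₂ (proj₂ (system i)) q mq))

  length-code : ∀ 𝒫 → IsSystem 𝒫 → ∀ x → length (code x 𝒫) ≡ k + length 𝒫 ∸ 1
  length-code 𝒫 system x = begin
    length (code x 𝒫)                                         ≡⟨ length-joinMap (block x) 𝒫 ⟩
    sum (L.map (length ∘ block x) 𝒫) + length 𝒫 ∸ 1          ≡⟨ cong (λ s → s + length 𝒫 ∸ 1) blocks ⟩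
    length (allCoords 𝒫) + length 𝒫 ∸ 1                      ≡⟨ cong (λ s → s + length 𝒫 ∸ 1) total ⟩
    k + length 𝒫 ∸ 1                                          ∎
    where
      open ≡-Reasoning
      blocks : sum (L.map (length ∘ block x) 𝒫) ≡ length (allCoords 𝒫)
      blocks = trans (cong sum (L.map-cong (length-block x) 𝒫)) (sym (length-concatMap coords 𝒫))
      total : length (allCoords 𝒫) ≡ k
      total = trans (↭-length (allCoords↭allFin 𝒫 system)) (L.length-tabulate (λ i → i))

  hamming-code : ∀ 𝒫 → IsSystem 𝒫 → ∀ x y → hamming (code x 𝒫) (code y 𝒫) ≡ ham x y
  hamming-code 𝒫 system x y = begin
    hamming (code x 𝒫) (code y 𝒫)
      ≡⟨ hamming-joinMap (block x) (block y) (λ P → trans (length-block x P) (sym (length-block y P))) 𝒫 ⟩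
    sum (L.map (λ P → hamming (block x P) (block y P)) 𝒫)
      ≡⟨ cong sum (L.map-cong (hamming-block x y) 𝒫) ⟩
    sum (L.map (sum ∘ L.map (coordDist x y) ∘ coords) 𝒫)
      ≡⟨ sym (sum-map-concatMap (coordDist x y) coords 𝒫) ⟩
    sum (L.map (coordDist x y) (allCoords 𝒫))
      ≡⟨ sum-↭ (↭-map⁺ (coordDist x y) (allCoords↭allFin 𝒫 system)) ⟩
    sum (L.map (coordDist x y) (allFin k))
      ≡⟨ sum-coordDist x y ⟩
    ham x y ∎
    where open ≡-Reasoning

lemma3p2 : (G : Graph) (k : ℕ) (idim : IsIdim G k) →
           let open Semicubes G k (proj₁ idim) in
           (𝒫 : List CoordPath) → IsSystem 𝒫 →
           IsometricEmbedding G (Γ (k + length 𝒫 ∸ 1))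
lemma3p2 G k idim 𝒫 system = hamming-preserving⇒isometric β vertex preserves
  where
    -- only the embedding is used
    β : IsometricEmbedding G (Q k)
    β = proj₁ idim
    open CoordinateCode β
    β⟨_⟩ : V G → Vec Bool k
    β⟨_⟩ = IsometricEmbedding.map β

    vertex : V G → V (Γ (k + length 𝒫 ∸ 1))
    vertex u = fibVertex (code β⟨ u ⟩ 𝒫) (length-code 𝒫 system β⟨ u ⟩) (fib-code u 𝒫)

    preserves : ∀ u v → ham (proj₁ (vertex u)) (proj₁ (vertex v)) ≡ ham β⟨ u ⟩ β⟨ v ⟩
    preserves u v = trans
      (cong₂ hamming (toList-fibVertex _ (length-code 𝒫 system β⟨ u ⟩) (fib-code u 𝒫))
                     (toList-fibVertex _ (length-code 𝒫 system β⟨ v ⟩) (fib-code v 𝒫)))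
      (hamming-code 𝒫 system β⟨ u ⟩ β⟨ v ⟩)
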